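{- Let $n\ge 2$ and $0\le p_1\le\cdots\le p_n$, and set $S_0=0$, $S_m=\sum_{i=1}^m p_i$. Let $T$ be a complete binary tree with $n$ leaves, and let $(i_0,i_1,\ldots,i_h)$ be a complete sequence representing $T$. Then the cost of $T$ equals $\sum_{k=1}^h S_{2i_k-i_{k-1}}$.
   Context: A binary tree is complete if every internal node has exactly two children. Given $h$, place the root of $T$ at level $h$ and each child one level below its parent (this requires the height of $T$ to be at most $h$); a sequence $(i_0,\dots,i_h)$ represents $T$ if for each $0\le k\le h$, $i_k$ is the number of internal nodes of $T$ at levels $\le k$. A sequence $(i_0,\ldots,i_h)$ is valid if there is $t\ge 0$ with $i_0=\cdots=i_t=0$ and $0<i_{t+1}<\cdots<i_h\le n-1$, and $2i_k-i_{k-1}\le n$ for all $1\le k\le h$; it is complete if it is valid and $i_h=n-1$. The cost of $T$ is the minimum, over all bijections assigning the weights $p_1,\dots,p_n$ to the leaves of $T$, of $\sum$ (weight of leaf) $\times$ (distance of the leaf from the root).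
   Formalization: The weights $p_1,\dots,p_n$ are rational numbers. -}

module Defs where

open import Data.Nat as ℕ using (ℕ; zero; suc; _≤_; _<_; _∸_; _≤?_; _⊔_)
open import Data.Fin as Fin using (Fin; toℕ; splitAt)
open import Data.Sum using (inj₁; inj₂)
open import Data.Bool using (if_then_else_)
open import Data.List using (List; []; _∷_; _++_; map; filter; length)
open import Data.Integer using (+_)
open import Data.Rational as ℚ using (ℚ; 0ℚ; _/_)
open import Data.Product using (Σ; _×_; ∃)
open import Relation.Binary.PropositionalEquality using (_≡_)

data Tree : Set where
  leaf : Tree
  node : Tree → Tree → Tree

leaves : Tree → ℕ
leaves leaf       = 1
leaves (node l r) = leaves l ℕ.+ leaves r

height : Tree → ℕ
height leaf       = 0
height (node l r) = suc (height l ⊔ height r)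

leafDepth : (T : Tree) → Fin (leaves T) → ℕ
leafDepth leaf       _ = 0
leafDepth (node l r) j with splitAt (leaves l) j
... | inj₁ a = suc (leafDepth l a)
... | inj₂ b = suc (leafDepth r b)

internalDepths : Tree → List ℕ
internalDepths leaf       = []
internalDepths (node l r) = 0 ∷ map suc (internalDepths l ++ internalDepths r)

-- With the root at level h, a node at depth d is at level h ∸ d (d ≤ h).
-- Level h ∸ d ≤ k  iff  h ≤ d + k  (for d ≤ h).
-- Number of internal nodes of T at levels ≤ k:
internalUpTo : ℕ → Tree → ℕ → ℕ
internalUpTo h T k = length (filter (λ d → h ≤? d ℕ.+ k) (internalDepths T))

-- (i₀,…,i_h) (given as i : ℕ → ℕ, only values 0..h matter) represents T
Represents : (h : ℕ) → (ℕ → ℕ) → Tree → Set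
Represents h i T = height T ≤ h × (∀ k → k ≤ h → i k ≡ internalUpTo h T k)

Valid : (n h : ℕ) → (ℕ → ℕ) → Set
Valid n h i = Σ ℕ λ t →
    t ≤ h
  × (∀ k → k ≤ t → i k ≡ 0)
  × (∀ k → t < k → k ≤ h → 0 < i k)
  × (∀ k → t < k → k < h → i k < i (suc k))
  × (i h ≤ n ∸ 1)
  × (∀ k → 1 ≤ k → k ≤ h → 2 ℕ.* i k ∸ i (k ∸ 1) ≤ n)

CompleteSeq : (n h : ℕ) → (ℕ → ℕ) → Set
CompleteSeq n h i = Valid n h i × i h ≡ n ∸ 1

sumℚ : (m : ℕ) → (Fin m → ℚ) → ℚ
sumℚ zero    f = 0ℚ
sumℚ (suc m) f = f Fin.zero ℚ.+ sumℚ m (λ j → f (Fin.suc j))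

ℕtoℚ : ℕ → ℚ
ℕtoℚ d = + d / 1

-- prefix sums S_m = p_1 + … + p_m (weights indexed 0..n-1); S_0 = 0
S : {n : ℕ} → (Fin n → ℚ) → ℕ → ℚ
S {n} p m = sumℚ n (λ j → if toℕ j ℕ.<ᵇ m then p j else 0ℚ)

-- A leaf at depth e sits at level h − e, and e is the number of levels k < h
-- with h − e ≤ k; so the cost of an assignment is the sum over k < h of the
-- weight put on the leaves at level ≤ k.  Every node at level ≤ k other than
-- the root is one of the two children of an internal node at level ≤ k + 1,
-- so there are 2 i_{k+1} − i_k such leaves, and the weight on them is at
-- least the sum S_{2 i_{k+1} − i_k} of that many smallest weights.  Giving the
-- smallest weights to the deepest leaves attains all these bounds at once,
-- because then every set of leaves at level ≤ k receives a prefix of the weights.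
module Submission where

open import Defs
open import Data.Nat using (ℕ; _≤_; _∸_)
open import Data.Fin using (Fin)
open import Data.Fin.Permutation using (Permutation′; _⟨$⟩ʳ_)
open import Data.Rational as ℚ using (ℚ; 0ℚ)
open import Data.Product using (Σ; _×_)
open import Relation.Binary.PropositionalEquality using (_≡_)

open import Algebra.Bundles using (Monoid; Ring)
import Algebra.Properties.Monoid.Sum as MonoidSum
import Algebra.Properties.Semiring.Sum as SemiringSum
open import Data.Bool using (Bool; true; false; if_then_else_; T)
open import Data.Empty using (⊥-elim)
open import Data.Fin as F using (zero; suc; toℕ; punchIn; _↑ˡ_; _↑ʳ_; splitAt)
import Data.Fin.Permutation as Perm
open import Data.Fin.Permutation using (_⟨$⟩ˡ_)
import Data.Fin.Properties as FP
open import Data.Integer using (+_)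
import Data.Integer.Properties as ZP
open import Data.List using ([]; _∷_; _++_; map; filter; length)
import Data.List.Properties as LP
open import Data.Nat as N using (_+_; _*_; _<_; z≤n; s≤s; _≤ᵇ_; _<ᵇ_; _≤?_)
import Data.Nat.Coprimality as Coprimality
import Data.Nat.Properties as NP
open import Data.Nat.Solver using (module +-*-Solver)
open import Data.Product using (_,_; proj₁; proj₂)
open import Data.Sum using (inj₁; inj₂)
open import Data.Unit using (tt)
open import Function using (_∘_)
open import Level using (Level)
open import Relation.Binary.PropositionalEquality
  using (refl; sym; trans; cong; cong₂; subst; subst₂; module ≡-Reasoning)
open import Relation.Nullary.Decidable using (does; dec-false; does-⇔)
open import Function.Bundles using (mk⇔)
open import Relation.Unary using (Pred; Decidable)
import Data.Rational.Properties as QP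

private
  variable
    a c ℓ : Level
    A B : Set a

module _ (M : Monoid c ℓ) where
  open Monoid M using (Carrier; _≈_; _∙_; ∙-congˡ; assoc; identityˡ)
    renaming (sym to ≈-sym; trans to ≈-trans)
  open MonoidSum M using (sum)

  sum-↑ : ∀ m n (f : Fin (m + n) → Carrier) →
          sum f ≈ sum (λ x → f (x ↑ˡ n)) ∙ sum (λ y → f (m ↑ʳ y))
  sum-↑ N.zero    n f = ≈-sym (identityˡ _)
  sum-↑ (N.suc m) n f = ≈-trans (∙-congˡ (sum-↑ m n (f ∘ suc))) (≈-sym (assoc _ _ _))

open SemiringSum (Ring.semiring QP.+-*-ring)
  using (sum; sum-syntax; sum-cong-≗; ∑-comm; *-distribˡ-sum; ∑-permute)
module ℕΣ = SemiringSum NP.+-*-semiring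

sumℚ≡∑ : ∀ m (f : Fin m → ℚ) → sumℚ m f ≡ ∑[ j < m ] f j
sumℚ≡∑ N.zero    f = refl
sumℚ≡∑ (N.suc m) f = cong (f zero ℚ.+_) (sumℚ≡∑ m (f ∘ suc))

∑-mono-≤ : ∀ {m} {f g : Fin m → ℚ} → (∀ j → f j ℚ.≤ g j) → ∑[ j < m ] f j ℚ.≤ ∑[ j < m ] g j
∑-mono-≤ {N.zero}  f≤g = QP.≤-refl
∑-mono-≤ {N.suc m} f≤g = QP.+-mono-≤ (f≤g zero) (∑-mono-≤ (f≤g ∘ suc))

iverson : Bool → ℕ
iverson b = if b then 1 else 0

[_]·_ : Bool → ℚ → ℚ
[ b ]· x = if b then x else 0ℚ

size : ∀ {n} → (Fin n → Bool) → ℕ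
size Q = ℕΣ.sum (λ j → iverson (Q j))

weight : ∀ {n} → (Fin n → ℚ) → (Fin n → Bool) → ℚ
weight {n} p Q = ∑[ j < n ] [ Q j ]· p j

prefix : ∀ {n} → ℕ → Fin n → Bool
prefix c j = toℕ j <ᵇ c

DownClosed : ∀ {n} → (Fin n → Bool) → Set
DownClosed Q = ∀ a b → a F.≤ b → T (Q b) → T (Q a)

Sorted : ∀ {n} → (Fin n → ℚ) → Set
Sorted p = ∀ a b → a F.≤ b → p a ℚ.≤ p b

S≡weight-prefix : ∀ {n} (p : Fin n → ℚ) c → S p c ≡ weight p (prefix c)
S≡weight-prefix {n} p c = sumℚ≡∑ n _

size≤ : ∀ {n} (Q : Fin n → Bool) → size Q ≤ n
size≤ {N.zero}  Q = z≤n
size≤ {N.suc n} Q with Q zero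
... | true  = s≤s (size≤ (Q ∘ suc))
... | false = NP.m≤n⇒m≤1+n (size≤ (Q ∘ suc))

size-empty : ∀ {n} (Q : Fin n → Bool) → (∀ j → Q j ≡ false) → size Q ≡ 0
size-empty {n} Q empty = trans (ℕΣ.sum-cong-≗ (cong iverson ∘ empty)) (ℕΣ.sum-replicate-zero n)

size-permute : ∀ {n} (Q : Fin n → Bool) (π : Permutation′ n) → size (Q ∘ (π ⟨$⟩ʳ_)) ≡ size Q
size-permute Q π = sym (ℕΣ.∑-permute (iverson ∘ Q) π)

Sorted-suc : ∀ {n} {p : Fin (N.suc n) → ℚ} → Sorted p → Sorted (p ∘ suc)
Sorted-suc sorted a b a≤b = sorted (suc a) (suc b) (s≤s a≤b)

DownClosed-suc : ∀ {n} {Q : Fin (N.suc n) → Bool} → DownClosed Q → DownClosed (Q ∘ suc)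
DownClosed-suc closed a b a≤b = closed (suc a) (suc b) (s≤s a≤b)

weight-prefix-suc : ∀ {n} (p : Fin (N.suc n) → ℚ) → Sorted p → ∀ c → c ≤ n →
                    weight p (prefix c) ℚ.≤ weight (p ∘ suc) (prefix c)
weight-prefix-suc p sorted N.zero _ = QP.≤-reflexive (QP.+-identityˡ _)
weight-prefix-suc {N.suc n} p sorted (N.suc c) (s≤s c≤n) =
  QP.+-mono-≤ (sorted zero (suc zero) z≤n) (weight-prefix-suc (p ∘ suc) (Sorted-suc sorted) c c≤n)

-- The prefix of size |Q| consists of the |Q| smallest weights.
weight-prefix-size≤ : ∀ {n} (p : Fin n → ℚ) → Sorted p → (Q : Fin n → Bool) →
                      weight p (prefix (size Q)) ℚ.≤ weight p Q
weight-prefix-size≤ {N.zero}  p sorted Q = QP.≤-refl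
weight-prefix-size≤ {N.suc n} p sorted Q with Q zero
... | true  = QP.+-monoʳ-≤ (p zero) (weight-prefix-size≤ (p ∘ suc) (Sorted-suc sorted) (Q ∘ suc))
... | false = begin
  weight p (prefix (size (Q ∘ suc)))         ≤⟨ weight-prefix-suc p sorted _ (size≤ (Q ∘ suc)) ⟩
  weight (p ∘ suc) (prefix (size (Q ∘ suc))) ≤⟨ weight-prefix-size≤ (p ∘ suc) (Sorted-suc sorted) (Q ∘ suc) ⟩
  weight (p ∘ suc) (Q ∘ suc)                 ≡⟨ QP.+-identityˡ _ ⟨
  0ℚ ℚ.+ weight (p ∘ suc) (Q ∘ suc)          ∎
  where open QP.≤-Reasoning

DownClosed-empty : ∀ {n} (Q : Fin (N.suc n) → Bool) → DownClosed Q → Q zero ≡ false →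
                   ∀ j → Q j ≡ false
DownClosed-empty Q closed Q₀≡false j with Q j in Qj≡
... | false = refl
... | true  = ⊥-elim (subst T Q₀≡false (closed zero j z≤n (subst T (sym Qj≡) tt)))

DownClosed⇒prefix : ∀ {n} (Q : Fin n → Bool) → DownClosed Q → ∀ j → Q j ≡ prefix (size Q) j
DownClosed⇒prefix {N.suc n} Q closed j with Q zero in Q₀≡
DownClosed⇒prefix {N.suc n} Q closed zero    | true  = Q₀≡
DownClosed⇒prefix {N.suc n} Q closed (suc j) | true  = DownClosed⇒prefix (Q ∘ suc) (DownClosed-suc closed) j
DownClosed⇒prefix {N.suc n} Q closed j       | false =
  trans (empty j) (cong (toℕ j <ᵇ_) (sym (size-empty (Q ∘ suc) (empty ∘ suc))))
  where
  empty : ∀ j → Q j ≡ false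
  empty = DownClosed-empty Q closed Q₀≡

-- A depth as a number of levels

ℕtoℚ-suc : ∀ m → ℕtoℚ (N.suc m) ≡ ℚ.1ℚ ℚ.+ ℕtoℚ m
ℕtoℚ-suc m rewrite QP.normalize-coprime {m} {0} (Coprimality.sym (Coprimality.1-coprimeTo m))
                 | ZP.*-identityʳ (+ m) = refl

suc-≤ᵇ-suc : ∀ m n → (N.suc m ≤ᵇ N.suc n) ≡ (m ≤ᵇ n)
suc-≤ᵇ-suc N.zero    n = refl
suc-≤ᵇ-suc (N.suc m) n = refl

∑-[a≤ᵇk] : ∀ m a → ∑[ k < m ] [ a ≤ᵇ toℕ k ]· ℚ.1ℚ ≡ ℕtoℚ (m ∸ a)
∑-[a≤ᵇk] N.zero    N.zero    = refl
∑-[a≤ᵇk] N.zero    (N.suc a) = refl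
∑-[a≤ᵇk] (N.suc m) N.zero    = trans (cong (ℚ.1ℚ ℚ.+_) (∑-[a≤ᵇk] m 0)) (sym (ℕtoℚ-suc m))
∑-[a≤ᵇk] (N.suc m) (N.suc a) = begin
  0ℚ ℚ.+ ∑[ k < m ] [ N.suc a ≤ᵇ N.suc (toℕ k) ]· ℚ.1ℚ ≡⟨ QP.+-identityˡ _ ⟩
  ∑[ k < m ] [ N.suc a ≤ᵇ N.suc (toℕ k) ]· ℚ.1ℚ         ≡⟨ sum-cong-≗ {m} (λ k → cong ([_]· ℚ.1ℚ) (suc-≤ᵇ-suc a (toℕ k))) ⟩
  ∑[ k < m ] [ a ≤ᵇ toℕ k ]· ℚ.1ℚ                       ≡⟨ ∑-[a≤ᵇk] m a ⟩
  ℕtoℚ (m ∸ a)                                          ∎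
  where open ≡-Reasoning

depth-by-levels : ∀ {h e} → e ≤ h → ℕtoℚ e ≡ ∑[ k < h ] [ h ≤ᵇ e + toℕ k ]· ℚ.1ℚ
depth-by-levels {h} {e} e≤h = begin
  ℕtoℚ e                                 ≡⟨ cong ℕtoℚ (NP.m∸[m∸n]≡n e≤h) ⟨
  ℕtoℚ (h ∸ (h ∸ e))                     ≡⟨ ∑-[a≤ᵇk] h (h ∸ e) ⟨
  ∑[ k < h ] [ h ∸ e ≤ᵇ toℕ k ]· ℚ.1ℚ    ≡⟨ sum-cong-≗ {h} (λ k → cong ([_]· ℚ.1ℚ) (level-shift (toℕ k))) ⟨
  ∑[ k < h ] [ h ≤ᵇ e + toℕ k ]· ℚ.1ℚ    ∎
  where
  open ≡-Reasoning
  level-shift : ∀ k → (h ≤ᵇ e + k) ≡ (h ∸ e ≤ᵇ k)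
  level-shift k = does-⇔ (mk⇔ (NP.m≤n+o⇒m∸n≤o h e)
                              (λ h∸e≤k → subst (_≤ e + k) (NP.m+[n∸m]≡n e≤h) (NP.+-monoʳ-≤ e h∸e≤k)))
                         (h ≤? e + k) (h ∸ e ≤? k)

*-[]·1 : ∀ b x → x ℚ.* ([ b ]· ℚ.1ℚ) ≡ [ b ]· x
*-[]·1 true  x = QP.*-identityʳ x
*-[]·1 false x = QP.*-zeroʳ x

atLevel≤ : ∀ {n} → ℕ → (Fin n → ℕ) → ℕ → Fin n → Bool
atLevel≤ h d k j = h ≤ᵇ d j + k

cost-by-levels : ∀ {n} h (w : Fin n → ℚ) (e : Fin n → ℕ) → (∀ x → e x ≤ h) →
                 ∑[ x < n ] (w x ℚ.* ℕtoℚ (e x)) ≡ ∑[ k < h ] weight w (atLevel≤ h e (toℕ k))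
cost-by-levels {n} h w e e≤h = begin
  ∑[ x < n ] (w x ℚ.* ℕtoℚ (e x))
    ≡⟨ sum-cong-≗ {n} (λ x → cong (w x ℚ.*_) (depth-by-levels (e≤h x))) ⟩
  ∑[ x < n ] (w x ℚ.* ∑[ k < h ] [ atLevel≤ h e (toℕ k) x ]· ℚ.1ℚ)
    ≡⟨ sum-cong-≗ {n} (λ x → *-distribˡ-sum {h} (w x) (λ k → [ atLevel≤ h e (toℕ k) x ]· ℚ.1ℚ)) ⟩
  ∑[ x < n ] ∑[ k < h ] (w x ℚ.* [ atLevel≤ h e (toℕ k) x ]· ℚ.1ℚ)
    ≡⟨ sum-cong-≗ {n} (λ x → sum-cong-≗ {h} (λ k → *-[]·1 _ (w x))) ⟩
  ∑[ x < n ] ∑[ k < h ] [ atLevel≤ h e (toℕ k) x ]· w x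
    ≡⟨ ∑-comm {n} {h} _ ⟩
  ∑[ k < h ] weight w (atLevel≤ h e (toℕ k)) ∎
  where open ≡-Reasoning

-- Counting nodes of a tree level by level

leavesUpTo : ℕ → Tree → ℕ → ℕ
leavesUpTo h T k = size (atLevel≤ h (leafDepth T) k)

leafDepth≤height : ∀ T j → leafDepth T j ≤ height T
leafDepth≤height leaf       j = z≤n
leafDepth≤height (node l r) j with splitAt (leaves l) j
... | inj₁ x = s≤s (NP.≤-trans (leafDepth≤height l x) (NP.m≤m⊔n (height l) (height r)))
... | inj₂ y = s≤s (NP.≤-trans (leafDepth≤height r y) (NP.m≤n⊔m (height l) (height r)))

leafDepth-↑ˡ : ∀ l r x → leafDepth (node l r) (x ↑ˡ leaves r) ≡ N.suc (leafDepth l x)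
leafDepth-↑ˡ l r x rewrite FP.splitAt-↑ˡ (leaves l) x (leaves r) = refl

leafDepth-↑ʳ : ∀ l r y → leafDepth (node l r) (leaves l ↑ʳ y) ≡ N.suc (leafDepth r y)
leafDepth-↑ʳ l r y rewrite FP.splitAt-↑ʳ (leaves l) (leaves r) y = refl

level-suc : ∀ h d k → (h ≤ᵇ N.suc d + k) ≡ (h ≤ᵇ d + N.suc k)
level-suc h d k = cong (h ≤ᵇ_) (sym (NP.+-suc d k))

leavesUpTo-node : ∀ h l r k →
  leavesUpTo h (node l r) k ≡ leavesUpTo h l (N.suc k) + leavesUpTo h r (N.suc k)
leavesUpTo-node h l r k = trans (sum-↑ NP.+-0-monoid (leaves l) (leaves r) _)
  (cong₂ _+_ (ℕΣ.sum-cong-≗ (cong iverson ∘ left)) (ℕΣ.sum-cong-≗ (cong iverson ∘ right)))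
  where
  at≤k : Fin (leaves (node l r)) → Bool
  at≤k = atLevel≤ h (leafDepth (node l r)) k
  left : ∀ x → at≤k (x ↑ˡ leaves r) ≡ atLevel≤ h (leafDepth l) (N.suc k) x
  left x = trans (cong (λ d → h ≤ᵇ d + k) (leafDepth-↑ˡ l r x)) (level-suc h (leafDepth l x) k)
  right : ∀ y → at≤k (leaves l ↑ʳ y) ≡ atLevel≤ h (leafDepth r) (N.suc k) y
  right y = trans (cong (λ d → h ≤ᵇ d + k) (leafDepth-↑ʳ l r y)) (level-suc h (leafDepth r y) k)

length-filter-map : ∀ {P : Pred B ℓ} (P? : Decidable P) (f : A → B) xs →
                    length (filter P? (map f xs)) ≡ length (filter (P? ∘ f) xs)
length-filter-map P? f []       = refl
length-filter-map P? f (x ∷ xs) with does (P? (f x))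
... | true  = cong N.suc (length-filter-map P? f xs)
... | false = length-filter-map P? f xs

internalUpTo-subtrees : ∀ h l r k →
  length (filter (λ d → h ≤? d + k) (map N.suc (internalDepths l ++ internalDepths r))) ≡
  internalUpTo h l (N.suc k) + internalUpTo h r (N.suc k)
internalUpTo-subtrees h l r k = begin
  length (filter (λ d → h ≤? d + k) (map N.suc (Dl ++ Dr)))
    ≡⟨ length-filter-map (λ d → h ≤? d + k) N.suc (Dl ++ Dr) ⟩
  length (filter (λ d → h ≤? N.suc d + k) (Dl ++ Dr))
    ≡⟨ cong length (LP.filter-≐ _ _ (shift , unshift) (Dl ++ Dr)) ⟩
  length (filter at≤k+1? (Dl ++ Dr))
    ≡⟨ cong length (LP.filter-++ at≤k+1? Dl Dr) ⟩
  length (filter at≤k+1? Dl ++ filter at≤k+1? Dr)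
    ≡⟨ LP.length-++ (filter at≤k+1? Dl) ⟩
  internalUpTo h l (N.suc k) + internalUpTo h r (N.suc k) ∎
  where
  open ≡-Reasoning
  Dl = internalDepths l
  Dr = internalDepths r
  at≤k+1? : Decidable (λ d → h ≤ d + N.suc k)
  at≤k+1? = λ d → h ≤? d + N.suc k
  shift : ∀ {d} → h ≤ N.suc d + k → h ≤ d + N.suc k
  shift {d} = subst (h ≤_) (sym (NP.+-suc d k))
  unshift : ∀ {d} → h ≤ d + N.suc k → h ≤ N.suc d + k
  unshift {d} = subst (h ≤_) (NP.+-suc d k)

internalUpTo-node : ∀ h l r k → internalUpTo h (node l r) k ≡
                    iverson (h ≤ᵇ k) + (internalUpTo h l (N.suc k) + internalUpTo h r (N.suc k))
internalUpTo-node h l r k with h ≤ᵇ k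
... | true  = cong N.suc (internalUpTo-subtrees h l r k)
... | false = internalUpTo-subtrees h l r k

internalUpTo+leavesUpTo : ∀ h T k →
  internalUpTo h T k + leavesUpTo h T k ≡ iverson (h ≤ᵇ k) + 2 * internalUpTo h T (N.suc k)
internalUpTo+leavesUpTo h leaf       k = refl
internalUpTo+leavesUpTo h (node l r) k
  rewrite internalUpTo-node h l r k | leavesUpTo-node h l r k | internalUpTo-node h l r (N.suc k) = begin
    (root + (Il + Ir)) + (Ll + Lr)
      ≡⟨ solve 5 (λ a b c d e → (a :+ (b :+ c)) :+ (d :+ e) := a :+ ((b :+ d) :+ (c :+ e))) refl root Il Ir Ll Lr ⟩
    root + ((Il + Ll) + (Ir + Lr))
      ≡⟨ cong₂ (λ u v → root + (u + v)) (internalUpTo+leavesUpTo h l (N.suc k)) (internalUpTo+leavesUpTo h r (N.suc k)) ⟩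
    root + ((child + 2 * Il′) + (child + 2 * Ir′))
      ≡⟨ solve 4 (λ a b c d → a :+ ((b :+ con 2 :* c) :+ (b :+ con 2 :* d)) := a :+ con 2 :* (b :+ (c :+ d))) refl root child Il′ Ir′ ⟩
    root + 2 * (child + (Il′ + Ir′)) ∎
  where
  open ≡-Reasoning
  open +-*-Solver
  root  = iverson (h ≤ᵇ k)
  child = iverson (h ≤ᵇ N.suc k)
  Il = internalUpTo h l (N.suc k)
  Ir = internalUpTo h r (N.suc k)
  Ll = leavesUpTo h l (N.suc k)
  Lr = leavesUpTo h r (N.suc k)
  Il′ = internalUpTo h l (N.suc (N.suc k))
  Ir′ = internalUpTo h r (N.suc (N.suc k))

leavesUpTo≡ : ∀ h T k → k < h → leavesUpTo h T k ≡ 2 * internalUpTo h T (N.suc k) ∸ internalUpTo h T k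
leavesUpTo≡ h T k k<h = begin
  leavesUpTo h T k                                         ≡⟨ NP.m+n∸m≡n (internalUpTo h T k) _ ⟨
  internalUpTo h T k + leavesUpTo h T k ∸ internalUpTo h T k
    ≡⟨ cong (_∸ internalUpTo h T k) (internalUpTo+leavesUpTo h T k) ⟩
  iverson (h ≤ᵇ k) + 2 * internalUpTo h T (N.suc k) ∸ internalUpTo h T k
    ≡⟨ cong (λ b → iverson b + 2 * internalUpTo h T (N.suc k) ∸ internalUpTo h T k) (dec-false (h ≤? k) (NP.<⇒≱ k<h)) ⟩
  2 * internalUpTo h T (N.suc k) ∸ internalUpTo h T k      ∎
  where open ≡-Reasoning

-- Sorting the leaves by decreasing depth

argmax : ∀ {n} (d : Fin (N.suc n) → ℕ) → Σ (Fin (N.suc n)) λ m → ∀ j → d j ≤ d m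
argmax {N.zero}  d = zero , λ { zero → NP.≤-refl }
argmax {N.suc n} d with argmax (d ∘ suc)
... | m , max with NP.≤-total (d (suc m)) (d zero)
...   | inj₁ dm≤d0 = zero  , λ { zero → NP.≤-refl ; (suc j) → NP.≤-trans (max j) dm≤d0 }
...   | inj₂ d0≤dm = suc m , λ { zero → d0≤dm ; (suc j) → max j }

sortDescending : ∀ {n} (d : Fin n → ℕ) →
  Σ (Permutation′ n) λ ρ → ∀ x y → x F.≤ y → d (ρ ⟨$⟩ʳ y) ≤ d (ρ ⟨$⟩ʳ x)
sortDescending {N.zero}  d = Perm.id , λ ()
sortDescending {N.suc n} d = ρ , antitone
  where
  m : Fin (N.suc n)
  m = proj₁ (argmax d)
  ρ′ = sortDescending (d ∘ punchIn m)
  ρ : Permutation′ (N.suc n)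
  ρ = Perm.insert zero m (proj₁ ρ′)
  ρ-suc : ∀ x → ρ ⟨$⟩ʳ suc x ≡ punchIn m (proj₁ ρ′ ⟨$⟩ʳ x)
  ρ-suc = Perm.insert-punchIn zero m (proj₁ ρ′)
  antitone : ∀ x y → x F.≤ y → d (ρ ⟨$⟩ʳ y) ≤ d (ρ ⟨$⟩ʳ x)
  antitone zero    y       _         = proj₂ (argmax d) (ρ ⟨$⟩ʳ y)
  antitone (suc x) (suc y) (s≤s x≤y) =
    subst₂ (λ u v → d u ≤ d v) (sym (ρ-suc y)) (sym (ρ-suc x)) (proj₂ ρ′ x y x≤y)

-- Optimal assignment of weights to depths

cost : ∀ {n} → (Fin n → ℚ) → (Fin n → ℕ) → Permutation′ n → ℚ
cost {n} p d τ = ∑[ j < n ] (p (τ ⟨$⟩ʳ j) ℚ.* ℕtoℚ (d j))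

optimalCost : ∀ {n} → (Fin n → ℚ) → ℕ → (Fin n → ℕ) → ℚ
optimalCost p h d = ∑[ k < h ] weight p (prefix (size (atLevel≤ h d (toℕ k))))

module _ {n} (p : Fin n → ℚ) (h : ℕ) (d : Fin n → ℕ) (d≤h : ∀ j → d j ≤ h) where

  cost≡∑-levels : ∀ τ → cost p d τ ≡ ∑[ k < h ] weight p (atLevel≤ h d (toℕ k) ∘ (τ ⟨$⟩ˡ_))
  cost≡∑-levels τ = begin
    ∑[ j < n ] (p (τ ⟨$⟩ʳ j) ℚ.* ℕtoℚ (d j))
      ≡⟨ sum-cong-≗ {n} (λ j → cong (λ i → p (τ ⟨$⟩ʳ j) ℚ.* ℕtoℚ (d i)) (Perm.inverseˡ τ)) ⟨
    ∑[ j < n ] (p (τ ⟨$⟩ʳ j) ℚ.* ℕtoℚ (d (τ ⟨$⟩ˡ (τ ⟨$⟩ʳ j))))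
      ≡⟨ ∑-permute (λ x → p x ℚ.* ℕtoℚ (d (τ ⟨$⟩ˡ x))) τ ⟨
    ∑[ x < n ] (p x ℚ.* ℕtoℚ (d (τ ⟨$⟩ˡ x)))
      ≡⟨ cost-by-levels h p (d ∘ (τ ⟨$⟩ˡ_)) (d≤h ∘ (τ ⟨$⟩ˡ_)) ⟩
    ∑[ k < h ] weight p (atLevel≤ h d (toℕ k) ∘ (τ ⟨$⟩ˡ_)) ∎
    where open ≡-Reasoning

  weight-prefix-size≡ : ∀ τ k → weight p (prefix (size (atLevel≤ h d k ∘ (τ ⟨$⟩ˡ_)))) ≡
                                weight p (prefix (size (atLevel≤ h d k)))
  weight-prefix-size≡ τ k = cong (weight p ∘ prefix) (size-permute (atLevel≤ h d k) (Perm.flip τ))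

  optimalCost≤cost : Sorted p → ∀ τ → optimalCost p h d ℚ.≤ cost p d τ
  optimalCost≤cost sorted τ = begin
    optimalCost p h d
      ≡⟨ sum-cong-≗ {h} (weight-prefix-size≡ τ ∘ toℕ) ⟨
    ∑[ k < h ] weight p (prefix (size (atLevel≤ h d (toℕ k) ∘ (τ ⟨$⟩ˡ_))))
      ≤⟨ ∑-mono-≤ {h} (λ k → weight-prefix-size≤ p sorted (atLevel≤ h d (toℕ k) ∘ (τ ⟨$⟩ˡ_))) ⟩
    ∑[ k < h ] weight p (atLevel≤ h d (toℕ k) ∘ (τ ⟨$⟩ˡ_))
      ≡⟨ cost≡∑-levels τ ⟨
    cost p d τ ∎
    where open QP.≤-Reasoning

  optimalCost-attained : Σ (Permutation′ n) λ τ → cost p d τ ≡ optimalCost p h d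
  optimalCost-attained = τ , cost-τ
    where
    ρ = sortDescending d
    τ : Permutation′ n
    τ = Perm.flip (proj₁ ρ)
    levels-closed : ∀ k → DownClosed (atLevel≤ h d k ∘ (τ ⟨$⟩ˡ_))
    levels-closed k a b a≤b at-b =
      NP.≤⇒≤ᵇ (NP.≤-trans (NP.≤ᵇ⇒≤ h _ at-b) (NP.+-monoˡ-≤ k (proj₂ ρ a b a≤b)))
    cost-τ : cost p d τ ≡ optimalCost p h d
    cost-τ = begin
      cost p d τ
        ≡⟨ cost≡∑-levels τ ⟩
      ∑[ k < h ] weight p (atLevel≤ h d (toℕ k) ∘ (τ ⟨$⟩ˡ_))
        ≡⟨ sum-cong-≗ {h} (λ k → sum-cong-≗ {n} (λ x →
             cong ([_]· p x) (DownClosed⇒prefix _ (levels-closed (toℕ k)) x))) ⟩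
      ∑[ k < h ] weight p (prefix (size (atLevel≤ h d (toℕ k) ∘ (τ ⟨$⟩ˡ_))))
        ≡⟨ sum-cong-≗ {h} (weight-prefix-size≡ τ ∘ toℕ) ⟩
      optimalCost p h d ∎
      where open ≡-Reasoning

Represents⇒optimalCost : ∀ {h i T} → Represents h i T → (p : Fin (leaves T) → ℚ) →
  sumℚ h (λ k → S p (2 * i (toℕ k + 1) ∸ i (toℕ k))) ≡ optimalCost p h (leafDepth T)
Represents⇒optimalCost {h} {i} {T} (_ , i≡internalUpTo) p =
  trans (sumℚ≡∑ h _) (sum-cong-≗ {h} (λ k → trans (S≡weight-prefix p (2 * i (toℕ k + 1) ∸ i (toℕ k)))
                                                   (cong (weight p ∘ prefix) (leaves-at k))))
  where
  leaves-at : ∀ (k : Fin h) → 2 * i (toℕ k + 1) ∸ i (toℕ k) ≡ leavesUpTo h T (toℕ k)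
  leaves-at k = begin
    2 * i (toℕ k + 1) ∸ i (toℕ k)
      ≡⟨ cong₂ (λ u v → 2 * u ∸ v) (trans (cong i (NP.+-comm (toℕ k) 1)) (i≡internalUpTo _ (FP.toℕ<n k)))
                                    (i≡internalUpTo _ (NP.<⇒≤ (FP.toℕ<n k))) ⟩
    2 * internalUpTo h T (N.suc (toℕ k)) ∸ internalUpTo h T (toℕ k)
      ≡⟨ leavesUpTo≡ h T (toℕ k) (FP.toℕ<n k) ⟨
    leavesUpTo h T (toℕ k) ∎
    where open ≡-Reasoning

lemma1 : (T : Tree) → 2 ≤ leaves T →
    (p : Fin (leaves T) → ℚ) →
    (∀ j → 0ℚ ℚ.≤ p j) →
    (∀ a b → a Data.Fin.≤ b → p a ℚ.≤ p b) →
    (h : ℕ) → (i : ℕ → ℕ) →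
    CompleteSeq (leaves T) h i → Represents h i T →
    let V = sumℚ h (λ k → S p (2 Data.Nat.* i (Data.Fin.toℕ k Data.Nat.+ 1) ∸ i (Data.Fin.toℕ k)))
        cost = λ (σ : Permutation′ (leaves T)) →
          sumℚ (leaves T) (λ j → p (σ ⟨$⟩ʳ j) ℚ.* ℕtoℚ (leafDepth T j))
    in (Σ (Permutation′ (leaves T)) λ σ → cost σ ≡ V)
       × (∀ (σ : Permutation′ (leaves T)) → V ℚ.≤ cost σ)
lemma1 T _ p _ sorted h i _ represents@(height≤h , _) =
  (proj₁ optimum , trans (sumℚ≡∑ n _) (trans (proj₂ optimum) (sym V≡optimal))) ,
  λ σ → subst₂ ℚ._≤_ (sym V≡optimal) (sym (sumℚ≡∑ n _)) (optimalCost≤cost p h d d≤h sorted σ)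
  where
  n = leaves T
  d = leafDepth T
  d≤h : ∀ j → d j ≤ h
  d≤h j = NP.≤-trans (leafDepth≤height T j) height≤h
  optimum : Σ (Permutation′ n) λ τ → cost p d τ ≡ optimalCost p h d
  optimum = optimalCost-attained p h d d≤h
  V≡optimal : sumℚ h (λ k → S p (2 * i (toℕ k + 1) ∸ i (toℕ k))) ≡ optimalCost p h d
  V≡optimal = Represents⇒optimalCost represents p
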